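{- Let $\mathcal{A}=(A,f)$ be a computable partial injection structure with unbounded finite chain character, and let $C$ be a cohesive set. (i) If $\mathrm{ran}(f)$ is computable, then $\prod_C\mathcal{A}$ has infinitely many $\omega$-chains; hence if $\mathcal{A}$ has only finitely many $\omega$-chains, then $\mathcal{A}\not\cong\prod_C\mathcal{A}$. (ii) If $\mathrm{dom}(f)$ is computable, then $\prod_C\mathcal{A}$ has infinitely many $\omega^*$-chains; hence if $\mathcal{A}$ has only finitely many $\omega^*$-chains, then $\mathcal{A}\not\cong\prod_C\mathcal{A}$.
   Context: A partial injection structure $(A,f)$ is a set $A$ with a partial function $f:A\to A$ that is one-to-one on its domain; it is viewed as the relational structure $(A,G_f)$ with $G_f=\{(x,y):x\in\mathrm{dom}(f),f(x)=y\}$, and it is computable if $A\subseteq\omega$ is computable, $f$ is partial computable and $G_f$ is computable. The orbit of $a$ is $\{b:\exists n\in\omega\,(f^n(a)\downarrow=b\vee f^n(b)\downarrow=a)\}$. An $\omega$-chain is an infinite orbit $\{x_i:i\in\omega\}$ of distinct elements with $x_0\notin\mathrm{ran}(f)$ and $x_{i+1}=f(x_i)$; an $\omega^*$-chain is an infinite orbit $\{x_i:i\in\omega\}$ of distinct elements with $x_0\notin\mathrm{dom}(f)$ and $x_i=f(x_{i+1})$. A $k$-chain is an orbit $\{x_1,\dots,x_k\}$ of distinct elements with $x_1\notin\mathrm{ran}(f)$, $x_{i+1}=f(x_i)$, $x_k\notin\mathrm{dom}(f)$; the finite chain character is $\{\langle k,n\rangle:k,n\ge1$ and $\mathcal{A}$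 has at least $n$ $k$-chains$\}$, unbounded if there is no upper bound on such $k$. A set $C\subseteq\omega$ is cohesive if it is infinite and for every c.e. set $W$, one of $W\cap C$, $\overline{W}\cap C$ is finite; $X\subseteq^*Y$ means $X\setminus Y$ is finite. The cohesive power $\prod_C\mathcal{A}$ has as domain the partial computable functions $\psi:\omega\to A$ with $C\subseteq^*\mathrm{dom}(\psi)$, modulo $\psi_1=_C\psi_2$ iff $C\subseteq^*\{i:\psi_1(i)\downarrow=\psi_2(i)\downarrow\}$, with $G([\psi],[\varphi])$ iff $C\subseteq^*\{i:(\psi(i),\varphi(i))\in G_f\}$; it is again a partial injection structure, whose orbits are defined likewise. -}

module Defs where

open import Data.Nat using (ℕ; zero; suc; _≤_; _<_)
open import Data.Fin using (Fin)
open import Data.Vec using (Vec; []; _∷_; lookup)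
open import Data.List using (List)
open import Data.List.Relation.Unary.Any using (Any)
open import Data.Product using (Σ; ∃; _×_; _,_; proj₁)
open import Data.Sum using (_⊎_)
open import Data.Empty using (⊥)
open import Relation.Nullary using (¬_)
open import Relation.Binary.PropositionalEquality using (_≡_; _≢_)

-- A model of computation: μ-recursive (partial recursive) functions.
-- "Partial computable" = given by such a code.

data Code : ℕ → Set where
  zer  : ∀ {n} → Code n
  succ : Code 1
  proj : ∀ {n} → Fin n → Code n
  comp : ∀ {m n} → Code m → Vec (Code n) m → Code n
  prec : ∀ {n} → Code n → Code (suc (suc n)) → Code (suc n)
  mu   : ∀ {n} → Code (suc n) → Code n

mutual
  data Eval : ∀ {n} → Code n → Vec ℕ n → ℕ → Set where
    e-zer  : ∀ {n} {xs : Vec ℕ n} → Eval zer xs 0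
    e-succ : ∀ {x} → Eval succ (x ∷ []) (suc x)
    e-proj : ∀ {n} {i : Fin n} {xs} → Eval (proj i) xs (lookup xs i)
    e-comp : ∀ {m n} {g : Code m} {hs : Vec (Code n) m} {xs ys y} →
             EvalAll hs xs ys → Eval g ys y → Eval (comp g hs) xs y
    e-prec0 : ∀ {n} {g : Code n} {h} {xs y} →
             Eval g xs y → Eval (prec g h) (0 ∷ xs) y
    e-precS : ∀ {n} {g : Code n} {h} {k xs r y} →
             Eval (prec g h) (k ∷ xs) r → Eval h (k ∷ r ∷ xs) y →
             Eval (prec g h) (suc k ∷ xs) y
    e-mu   : ∀ {n} {c : Code (suc n)} {xs y} →
             Eval c (y ∷ xs) 0 →
             (∀ z → z < y → ∃ λ v → Eval c (z ∷ xs) (suc v)) →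
             Eval (mu c) xs y

  data EvalAll {n} : ∀ {m} → Vec (Code n) m → Vec ℕ n → Vec ℕ m → Set where
    []  : ∀ {xs} → EvalAll [] xs []
    _∷_ : ∀ {m} {h} {hs : Vec (Code n) m} {xs y ys} →
          Eval h xs y → EvalAll hs xs ys → EvalAll (h ∷ hs) xs (y ∷ ys)

_⟨_⟩≃_ : Code 1 → ℕ → ℕ → Set
c ⟨ x ⟩≃ y = Eval c (x ∷ []) y

_⟨_⟩↓ : Code 1 → ℕ → Set
c ⟨ x ⟩↓ = ∃ λ y → c ⟨ x ⟩≃ y

ComputableSet : (ℕ → Set) → Set
ComputableSet S = Σ (Code 1) λ c →
  ∀ x → (S x × c ⟨ x ⟩≃ 1) ⊎ (¬ S x × c ⟨ x ⟩≃ 0)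

ComputableRel : (ℕ → ℕ → Set) → Set
ComputableRel R = Σ (Code 2) λ c →
  ∀ x y → (R x y × Eval c (x ∷ y ∷ []) 1) ⊎ (¬ R x y × Eval c (x ∷ y ∷ []) 0)

Finite : (ℕ → Set) → Set
Finite P = ∃ λ N → ∀ x → P x → x < N

Infinite : (ℕ → Set) → Set
Infinite P = ∀ n → ∃ λ m → n ≤ m × P m

_⊆*_ : (ℕ → Set) → (ℕ → Set) → Set
X ⊆* Y = ∃ λ N → ∀ i → N ≤ i → X i → Y i

W : Code 1 → ℕ → Set
W c x = c ⟨ x ⟩↓

Cohesive : (ℕ → Set) → Set
Cohesive C = Infinite C ×
  (∀ (c : Code 1) → Finite (λ x → W c x × C x) ⊎ Finite (λ x → ¬ W c x × C x))

-- Partial injection structures (relational presentation; domain is a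
-- setoid so that the cohesive power can be presented without quotients)

record Struct : Set₁ where
  field
    Carrier : Set
    _≈_     : Carrier → Carrier → Set
    G       : Carrier → Carrier → Set   -- graph of f

module _ (S : Struct) where
  open Struct S

  Iter : ℕ → Carrier → Carrier → Set
  Iter zero    x y = x ≈ y
  Iter (suc n) x y = ∃ λ z → G x z × Iter n z y

  InRan : Carrier → Set
  InRan x = ∃ λ z → G z x

  InDom : Carrier → Set
  InDom x = ∃ λ z → G x z

  SameOrbit : Carrier → Carrier → Set
  SameOrbit a b = ∃ λ n → Iter n a b ⊎ Iter n b a

  OmegaStart : Carrier → Set
  OmegaStart x = ¬ InRan x × (∀ n → ∃ λ y → Iter n x y) ×
    (∀ n m y y' → Iter n x y → Iter m x y' → y ≈ y' → n ≡ m)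

  OmegaStarStart : Carrier → Set
  OmegaStarStart x = ¬ InDom x × (∀ n → ∃ λ y → Iter n y x) ×
    (∀ n m y y' → Iter n y x → Iter m y' x → y ≈ y' → n ≡ m)

  -- x is x₁ of a k-chain (k ≥ 1): x₁,…,x_k = x, f(x), …, f^{k-1}(x)
  KChainStart : ℕ → Carrier → Set
  KChainStart zero    x = ⊥
  KChainStart (suc k) x = ¬ InRan x ×
    (∃ λ y → Iter k x y × ¬ InDom y) ×
    (∀ n m y y' → n ≤ k → m ≤ k → Iter n x y → Iter m x y' → y ≈ y' → n ≡ m)

  UnboundedFCC : Set
  UnboundedFCC = ∀ b → ∃ λ k → b < k × ∃ λ x → KChainStart k x

  InfManyOmega : Set
  InfManyOmega = Σ (ℕ → Carrier) λ s → (∀ i → OmegaStart (s i)) ×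
    (∀ i j → i ≢ j → ¬ SameOrbit (s i) (s j))

  InfManyOmegaStar : Set
  InfManyOmegaStar = Σ (ℕ → Carrier) λ s → (∀ i → OmegaStarStart (s i)) ×
    (∀ i j → i ≢ j → ¬ SameOrbit (s i) (s j))

  FinManyOmega : Set
  FinManyOmega = Σ (List Carrier) λ l → ∀ x → OmegaStart x → Any (SameOrbit x) l

  FinManyOmegaStar : Set
  FinManyOmegaStar = Σ (List Carrier) λ l → ∀ x → OmegaStarStart x → Any (SameOrbit x) l

record Iso (S T : Struct) : Set where
  private
    module S = Struct S
    module T = Struct T
  field
    to      : S.Carrier → T.Carrier
    from    : T.Carrier → S.Carrier
    to-cong   : ∀ {x y} → x S.≈ y → to x T.≈ to y
    from-cong : ∀ {x y} → x T.≈ y → from x S.≈ from y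
    from-to : ∀ x → from (to x) S.≈ x
    to-from : ∀ y → to (from y) T.≈ y
    G-to    : ∀ x y → S.G x y → T.G (to x) (to y)
    G-from  : ∀ x y → T.G (to x) (to y) → S.G x y

Dom : Code 1 → ℕ → Set
Dom cf x = cf ⟨ x ⟩↓

Ran : Code 1 → ℕ → Set
Ran cf y = ∃ λ x → cf ⟨ x ⟩≃ y

GraphOf : Code 1 → ℕ → ℕ → Set
GraphOf cf x y = cf ⟨ x ⟩≃ y

StructOf : (ℕ → Set) → Code 1 → Struct
StructOf A cf = record
  { Carrier = Σ ℕ A
  ; _≈_ = λ a b → proj₁ a ≡ proj₁ b
  ; G = λ a b → GraphOf cf (proj₁ a) (proj₁ b) }

IsComputablePIS : (ℕ → Set) → Code 1 → Set
IsComputablePIS A cf =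
  ComputableSet A ×
  ComputableRel (GraphOf cf) ×
  (∀ x y → cf ⟨ x ⟩≃ y → A x × A y) ×
  (∀ x x' y → cf ⟨ x ⟩≃ y → cf ⟨ x' ⟩≃ y → x ≡ x')

record PowerElt (A : ℕ → Set) (C : ℕ → Set) : Set where
  field
    ψ       : Code 1
    ψ-into  : ∀ i y → ψ ⟨ i ⟩≃ y → A y
    ψ-dom   : C ⊆* (λ i → ψ ⟨ i ⟩↓)

CohesivePower : (ℕ → Set) → Code 1 → (ℕ → Set) → Struct
CohesivePower A cf C = record
  { Carrier = PowerElt A C
  ; _≈_ = λ p q → C ⊆* (λ i → ∃ λ y →
        PowerElt.ψ p ⟨ i ⟩≃ y × PowerElt.ψ q ⟨ i ⟩≃ y)
  ; G = λ p q → C ⊆* (λ i → ∃ λ a → ∃ λ b →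
        PowerElt.ψ p ⟨ i ⟩≃ a × PowerElt.ψ q ⟨ i ⟩≃ b × GraphOf cf a b) }

{-# OPTIONS --safe #-}
-- Since ran f is computable, the preimage of a point can be computed, hence so can the walk of
-- i steps backwards from a point w.  Searching forwards for a chain start x with f^i(x) defined
-- need not terminate, but searching over the end point w and walking back does: uniformly in i
-- and b it finds a start x ≥ b of a chain with at least i steps, and such starts exist because
-- the finite chain character is unbounded (starts of chains of different lengths differ).
-- Repeating the search above the previous answer gives computable ψ₀ < ψ₁ < ⋯, pointwise.
-- In the cohesive power f^n[ψⱼ] is [f^n ∘ ψⱼ], defined on all i ≥ n; these points are pairwise
-- distinct and [ψⱼ] has no preimage, so [ψⱼ] starts an ω-chain, and different j give different
-- orbits because ψⱼ(i) ≠ ψₖ(i) both lie outside ran f.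
-- An isomorphism would pull these back to infinitely many ω-chains of A in different orbits.
-- Part (ii) is part (i) for f⁻¹, which is computable with range dom f, since ∏_C (A, f⁻¹) is the
-- converse of ∏_C (A, f).

module Submission where

open import Defs
open import Data.Nat
open import Data.Nat.Properties
open import Data.Fin using (Fin; toℕ; fromℕ<) renaming (zero to fz; suc to fs)
open import Data.Fin.Properties using (pigeonhole; any?; toℕ-fromℕ<)
open import Data.Vec using (Vec; []; _∷_)
open import Data.List using (List; length; lookup)
open import Data.List.Relation.Unary.Any as Any using (Any; index)
open import Data.List.Relation.Unary.Any.Properties using (lookup-index)
open import Data.Product
open import Data.Sum using (_⊎_; inj₁; inj₂; [_,_]′)
open import Data.Empty using (⊥-elim)
open import Relation.Nullary using (¬_; yes; no)
open import Relation.Binary using (tri<; tri≈; tri>)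
open import Relation.Binary.PropositionalEquality

mutual
  eval-functional : ∀ {n} {c : Code n} {xs y y′} → Eval c xs y → Eval c xs y′ → y ≡ y′
  eval-functional e-zer e-zer = refl
  eval-functional e-succ e-succ = refl
  eval-functional e-proj e-proj = refl
  eval-functional (e-comp hs g) (e-comp hs′ g′) with evalAll-functional hs hs′
  ... | refl = eval-functional g g′
  eval-functional (e-prec0 g) (e-prec0 g′) = eval-functional g g′
  eval-functional (e-precS r h) (e-precS r′ h′) with eval-functional r r′
  ... | refl = eval-functional h h′
  eval-functional {y = y} {y′} (e-mu root below) (e-mu root′ below′) with <-cmp y y′
  ... | tri< y<y′ _ _ = ⊥-elim (positive-¬zero (below′ y y<y′) root)
  ... | tri≈ _ y≡y′ _ = y≡y′
  ... | tri> _ _ y>y′ = ⊥-elim (positive-¬zero (below y′ y>y′) root′)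

  positive-¬zero : ∀ {n} {c : Code n} {xs} → (∃ λ v → Eval c xs (suc v)) → ¬ Eval c xs 0
  positive-¬zero (_ , pos) root with eval-functional pos root
  ... | ()

  evalAll-functional : ∀ {n m} {hs : Vec (Code n) m} {xs ys ys′} →
                       EvalAll hs xs ys → EvalAll hs xs ys′ → ys ≡ ys′
  evalAll-functional [] [] = refl
  evalAll-functional (e ∷ es) (e′ ∷ es′) = cong₂ _∷_ (eval-functional e e′) (evalAll-functional es es′)

eval-comp₁ : ∀ {n} {a : Code n} {g : Code 1} {xs u v} →
             Eval a xs u → g ⟨ u ⟩≃ v → Eval (comp g (a ∷ [])) xs v
eval-comp₁ ea eg = e-comp (ea ∷ []) eg

eval-comp₂ : ∀ {n} {a b : Code n} {g : Code 2} {xs u u′ v} →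
             Eval a xs u → Eval b xs u′ → Eval g (u ∷ u′ ∷ []) v → Eval (comp g (a ∷ b ∷ [])) xs v
eval-comp₂ ea eb eg = e-comp (ea ∷ eb ∷ []) eg

oneᶜ : ∀ {n} → Code n
oneᶜ = comp succ (zer ∷ [])

eval-oneᶜ : ∀ {n} {xs : Vec ℕ n} → Eval oneᶜ xs 1
eval-oneᶜ = eval-comp₁ e-zer e-succ

predᶜ : Code 1
predᶜ = prec zer (proj fz)

eval-predᶜ : ∀ x → predᶜ ⟨ x ⟩≃ pred x
eval-predᶜ zero = e-prec0 e-zer
eval-predᶜ (suc x) = e-precS (eval-predᶜ x) e-proj

-- Arguments in the order of the recursion: (y , x) ↦ x ∸ y.
monusᶜ : Code 2
monusᶜ = prec (proj fz) (comp predᶜ (proj (fs fz) ∷ []))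

eval-monusᶜ : ∀ y x → Eval monusᶜ (y ∷ x ∷ []) (x ∸ y)
eval-monusᶜ zero x = e-prec0 e-proj
eval-monusᶜ (suc y) x = subst (Eval monusᶜ (suc y ∷ x ∷ [])) (pred[m∸n]≡m∸[1+n] x y)
  (e-precS (eval-monusᶜ y x) (eval-comp₁ e-proj (eval-predᶜ (x ∸ y))))

plusᶜ : Code 2
plusᶜ = prec (proj fz) (comp succ (proj (fs fz) ∷ []))

eval-plusᶜ : ∀ y x → Eval plusᶜ (y ∷ x ∷ []) (y + x)
eval-plusᶜ zero x = e-prec0 e-proj
eval-plusᶜ (suc y) x = e-precS (eval-plusᶜ y x) (eval-comp₁ e-proj e-succ)

infixl 6 _∸ᶜ_ _+ᶜ_

_∸ᶜ_ : ∀ {n} → Code n → Code n → Code n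
a ∸ᶜ b = comp monusᶜ (b ∷ a ∷ [])

eval-∸ᶜ : ∀ {n} {a b : Code n} {xs u v} → Eval a xs u → Eval b xs v → Eval (a ∸ᶜ b) xs (u ∸ v)
eval-∸ᶜ {u = u} {v} ea eb = eval-comp₂ eb ea (eval-monusᶜ v u)

_+ᶜ_ : ∀ {n} → Code n → Code n → Code n
a +ᶜ b = comp plusᶜ (a ∷ b ∷ [])

eval-+ᶜ : ∀ {n} {a b : Code n} {xs u v} → Eval a xs u → Eval b xs v → Eval (a +ᶜ b) xs (u + v)
eval-+ᶜ {u = u} {v} ea eb = eval-comp₂ ea eb (eval-plusᶜ u v)

module _ {S : ℕ → Set} (cS : ComputableSet S) where

  χ : ℕ → ℕ
  χ x with proj₂ cS x
  ... | inj₁ _ = 1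
  ... | inj₂ _ = 0

  eval-χ : ∀ x → proj₁ cS ⟨ x ⟩≃ χ x
  eval-χ x with proj₂ cS x
  ... | inj₁ (_ , e) = e
  ... | inj₂ (_ , e) = e

  χ-∈ : ∀ {x} → S x → χ x ≡ 1
  χ-∈ {x} x∈S with proj₂ cS x
  ... | inj₁ _ = refl
  ... | inj₂ (x∉S , _) = ⊥-elim (x∉S x∈S)

  χ-∉ : ∀ {x} → ¬ S x → χ x ≡ 0
  χ-∉ {x} x∉S with proj₂ cS x
  ... | inj₁ (x∈S , _) = ⊥-elim (x∉S x∈S)
  ... | inj₂ _ = refl

  χ≡0⇒∉ : ∀ {x} → χ x ≡ 0 → ¬ S x
  χ≡0⇒∉ χx≡0 x∈S = 1+n≢0 (trans (sym (χ-∈ x∈S)) χx≡0)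

  1∸χ≡0⇒∈ : ∀ {x} → 1 ∸ χ x ≡ 0 → S x
  1∸χ≡0⇒∈ {x} 1∸χx≡0 with proj₂ cS x
  ... | inj₁ (x∈S , _) = x∈S
  ... | inj₂ _ = ⊥-elim (1+n≢0 1∸χx≡0)

module _ {R : ℕ → ℕ → Set} (cR : ComputableRel R) where

  χ₂ : ℕ → ℕ → ℕ
  χ₂ x y with proj₂ cR x y
  ... | inj₁ _ = 1
  ... | inj₂ _ = 0

  eval-χ₂ : ∀ x y → Eval (proj₁ cR) (x ∷ y ∷ []) (χ₂ x y)
  eval-χ₂ x y with proj₂ cR x y
  ... | inj₁ (_ , e) = e
  ... | inj₂ (_ , e) = e

  χ₂-∈ : ∀ {x y} → R x y → χ₂ x y ≡ 1
  χ₂-∈ {x} {y} r with proj₂ cR x y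
  ... | inj₁ _ = refl
  ... | inj₂ (¬r , _) = ⊥-elim (¬r r)

  1∸χ₂≡0⇒∈ : ∀ {x y} → 1 ∸ χ₂ x y ≡ 0 → R x y
  1∸χ₂≡0⇒∈ {x} {y} 1∸χ≡0 with proj₂ cR x y
  ... | inj₁ (r , _) = r
  ... | inj₂ _ = ⊥-elim (1+n≢0 1∸χ≡0)

module _ {n} (c : Code (suc n)) (xs : Vec ℕ n) (F : ℕ → ℕ) (eval-c : ∀ z → Eval c (z ∷ xs) (F z)) where

  private
    least-root-below : ∀ b → (∃ λ y → F y ≡ 0 × Eval (mu c) xs y) ⊎
                             (∀ z → z < b → ∃ λ v → Eval c (z ∷ xs) (suc v))
    least-root-below zero = inj₂ (λ _ ())
    least-root-below (suc b) with least-root-below b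
    ... | inj₁ root = inj₁ root
    ... | inj₂ positive with F b in Fb
    ...   | zero = inj₁ (b , Fb , e-mu (subst (Eval c (b ∷ xs)) Fb (eval-c b)) positive)
    ...   | suc v = inj₂ positive′
      where
      positive′ : ∀ z → z < suc b → ∃ λ v → Eval c (z ∷ xs) (suc v)
      positive′ z z<1+b with m≤n⇒m<n∨m≡n (≤-pred z<1+b)
      ... | inj₁ z<b = positive z z<b
      ... | inj₂ refl = v , subst (Eval c (z ∷ xs)) Fb (eval-c z)

  μ-halts : (∃ λ z → F z ≡ 0) → ∃ λ y → F y ≡ 0 × Eval (mu c) xs y
  μ-halts (z , Fz≡0) with least-root-below (suc z)
  ... | inj₁ root = root
  ... | inj₂ positive =
    ⊥-elim (positive-¬zero (positive z ≤-refl) (subst (Eval c (z ∷ xs)) Fz≡0 (eval-c z)))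

Iterate : Code 1 → ℕ → ℕ → ℕ → Set
Iterate g zero x y = x ≡ y
Iterate g (suc n) x y = ∃ λ z → g ⟨ x ⟩≃ z × Iterate g n z y

Injectiveᶜ : Code 1 → Set
Injectiveᶜ g = ∀ x x′ y → g ⟨ x ⟩≃ y → g ⟨ x′ ⟩≃ y → x ≡ x′

iterateᶜ : Code 1 → ℕ → Code 1 → Code 1
iterateᶜ g zero p = p
iterateᶜ g (suc m) p = comp g (iterateᶜ g m p ∷ [])

module _ {g : Code 1} where

  iterate-split : ∀ m n {x z} → Iterate g (m + n) x z → ∃ λ y → Iterate g m x y × Iterate g n y z
  iterate-split zero n {x} it = x , refl , it
  iterate-split (suc m) n (u , gu , it) with iterate-split m n it
  ... | y , front , back = y , (u , gu , front) , back

  iterate-unsnoc : ∀ n {x z} → Iterate g (suc n) x z → ∃ λ y → Iterate g n x y × g ⟨ y ⟩≃ z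
  iterate-unsnoc zero {x} (_ , gz , refl) = x , refl , gz
  iterate-unsnoc (suc n) (u , gu , it) with iterate-unsnoc n it
  ... | y , front , gy = y , (u , gu , front) , gy

  iterate-snoc : ∀ n {x y z} → Iterate g n x y → g ⟨ y ⟩≃ z → Iterate g (suc n) x z
  iterate-snoc zero refl gz = _ , gz , refl
  iterate-snoc (suc n) (u , gu , it) gz = u , gu , iterate-snoc n it gz

  iterate-ran : ∀ n {x z} → Iterate g (suc n) x z → Ran g z
  iterate-ran n it = let (y , _ , gy) = iterate-unsnoc n it in y , gy

  iterate-prefix : ∀ {m n x w} → m ≤ n → Iterate g n x w → ∃ (Iterate g m x)
  iterate-prefix {x = x} z≤n _ = x , refl
  iterate-prefix (s≤s m≤n) (z , gz , it) = let (y , it′) = iterate-prefix m≤n it in y , z , gz , it′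

  iterate-to-non-range : ∀ n {x y} → ¬ Ran g y → Iterate g n x y → x ≡ y
  iterate-to-non-range zero _ x≡y = x≡y
  iterate-to-non-range (suc n) y∉ran it = ⊥-elim (y∉ran (iterate-ran n it))

  iterate-length-to-non-domain : ∀ k k′ {x y y′} → Iterate g k x y → ¬ Dom g y →
                                 Iterate g k′ x y′ → ¬ Dom g y′ → k ≡ k′
  iterate-length-to-non-domain zero zero _ _ _ _ = refl
  iterate-length-to-non-domain zero (suc k′) refl y∉dom (z , gz , _) _ = ⊥-elim (y∉dom (z , gz))
  iterate-length-to-non-domain (suc k) zero (z , gz , _) _ refl y′∉dom = ⊥-elim (y′∉dom (z , gz))
  iterate-length-to-non-domain (suc k) (suc k′) (z , gz , it) y∉dom (z′ , gz′ , it′) y′∉dom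
    with eval-functional gz gz′
  ... | refl = cong suc (iterate-length-to-non-domain k k′ it y∉dom it′ y′∉dom)

  module _ (g-injective : Injectiveᶜ g) where

    iterate-injective : ∀ n {x x′ y} → Iterate g n x y → Iterate g n x′ y → x ≡ x′
    iterate-injective zero refl refl = refl
    iterate-injective (suc n) (u , gu , it) (u′ , gu′ , it′) with iterate-injective n it it′
    ... | refl = g-injective _ _ _ gu gu′

    iterate-length-from-non-range : ∀ n m {a b} → ¬ Ran g a → Iterate g n a b → Iterate g m a b → n ≡ m
    iterate-length-from-non-range zero zero _ _ _ = refl
    iterate-length-from-non-range zero (suc m) a∉ran refl it = ⊥-elim (a∉ran (iterate-ran m it))
    iterate-length-from-non-range (suc n) zero a∉ran it refl = ⊥-elim (a∉ran (iterate-ran n it))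
    iterate-length-from-non-range (suc n) (suc m) a∉ran it it′
      with iterate-unsnoc n it | iterate-unsnoc m it′
    ... | y , front , gy | y′ , front′ , gy′ with g-injective _ _ _ gy gy′
    ... | refl = cong suc (iterate-length-from-non-range n m a∉ran front front′)

    iterate-converge : ∀ {n m x y e} → n ≤ m → Iterate g n x e → Iterate g m y e → Iterate g (m ∸ n) y x
    iterate-converge {n} {m} {y = y} {e} n≤m it it′
      with iterate-split (m ∸ n) n (subst (λ k → Iterate g k y e) (sym (m∸n+n≡m n≤m)) it′)
    ... | u , front , back with iterate-injective n back it
    ... | refl = front

  eval-iterateᶜ : ∀ m {p i x y} → p ⟨ i ⟩≃ x → Iterate g m x y → iterateᶜ g m p ⟨ i ⟩≃ y
  eval-iterateᶜ zero eval-x refl = eval-x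
  eval-iterateᶜ (suc m) eval-x it =
    let (u , front , gu) = iterate-unsnoc m it in eval-comp₁ (eval-iterateᶜ m eval-x front) gu

-- Starts of long finite chains

increasing⇒monotone : ∀ {f : ℕ → ℕ} → (∀ m → f m < f (suc m)) → ∀ {m n} → m < n → f m < f n
increasing⇒monotone f↑ {m} (s≤s m≤n) with m≤n⇒m<n∨m≡n m≤n
... | inj₁ m<n = <-trans (increasing⇒monotone f↑ m<n) (f↑ _)
... | inj₂ refl = f↑ m

increasing⇒injective : ∀ {f : ℕ → ℕ} → (∀ m → f m < f (suc m)) → ∀ {m n} → f m ≡ f n → m ≡ n
increasing⇒injective f↑ {m} {n} fm≡fn with <-cmp m n
... | tri< m<n _ _ = ⊥-elim (<⇒≢ (increasing⇒monotone f↑ m<n) fm≡fn)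
... | tri≈ _ m≡n _ = m≡n
... | tri> _ _ n<m = ⊥-elim (<⇒≢ (increasing⇒monotone f↑ n<m) (sym fm≡fn))

injective⇒unbounded : ∀ {f : ℕ → ℕ} → (∀ {m n} → f m ≡ f n → m ≡ n) → ∀ b → ∃ λ j → b ≤ f j
injective⇒unbounded {f} f-injective b with any? (λ (j : Fin (suc b)) → b ≤? f (toℕ j))
... | yes (j , b≤fj) = toℕ j , b≤fj
... | no none with pigeonhole (n<1+n b) (λ j → fromℕ< (≰⇒> (λ b≤fj → none (j , b≤fj))))
... | j , j′ , j<j′ , same = ⊥-elim (<⇒≢ j<j′ (f-injective
        (trans (sym (toℕ-fromℕ< _)) (trans (cong toℕ same) (toℕ-fromℕ< _)))))

FiniteChain : (ℕ → Set) → Code 1 → ℕ → ℕ → Set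
FiniteChain A g k x = ¬ Ran g x × A x × ∃ λ y → Iterate g k x y × ¬ Dom g y

ArbitrarilyLongChains : (ℕ → Set) → Code 1 → Set
ArbitrarilyLongChains A g = ∀ b → ∃ λ k → b ≤ k × ∃ (FiniteChain A g k)

LongChainStart : (ℕ → Set) → Code 1 → ℕ → ℕ → Set
LongChainStart A g i x = ¬ Ran g x × A x × ∃ (Iterate g i x)

module _ {A : ℕ → Set} {g : Code 1} where

  finiteChain-length-unique : ∀ {k k′ x} → FiniteChain A g k x → FiniteChain A g k′ x → k ≡ k′
  finiteChain-length-unique {k} {k′} (_ , _ , _ , it , y∉dom) (_ , _ , _ , it′ , y′∉dom) =
    iterate-length-to-non-domain k k′ it y∉dom it′ y′∉dom

  module _ (chains : ArbitrarilyLongChains A g) (i : ℕ) where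

    private
      bound chainLength : ℕ → ℕ
      bound zero = i
      bound (suc m) = suc (chainLength m)
      chainLength m = proj₁ (chains (bound m))

      bound≤chainLength : ∀ m → bound m ≤ chainLength m
      bound≤chainLength m = proj₁ (proj₂ (chains (bound m)))

      i≤chainLength : ∀ m → i ≤ chainLength m
      i≤chainLength zero = bound≤chainLength zero
      i≤chainLength (suc m) = ≤-trans (≤-trans (i≤chainLength m) (n≤1+n _)) (bound≤chainLength (suc m))

      start : ℕ → ℕ
      start m = proj₁ (proj₂ (proj₂ (chains (bound m))))

      startChain : ∀ m → FiniteChain A g (chainLength m) (start m)
      startChain m = proj₂ (proj₂ (proj₂ (chains (bound m))))

      start-injective : ∀ {m n} → start m ≡ start n → m ≡ n
      start-injective {m} {n} same = increasing⇒injective (λ m → bound≤chainLength (suc m))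
        (finiteChain-length-unique (startChain m)
          (subst (FiniteChain A g (chainLength n)) (sym same) (startChain n)))

    longChainStarts-unbounded : ∀ b → ∃ λ x → b ≤ x × LongChainStart A g i x
    longChainStarts-unbounded b =
      let (j , b≤start) = injective⇒unbounded start-injective b
          (start∉ran , start∈A , _ , it , _) = startChain j
      in start j , b≤start , start∉ran , start∈A , iterate-prefix (i≤chainLength j) it

-- Enumerating chain starts computably

module ChainStartEnumeration {A : ℕ → Set} {g : Code 1}
  (cA : ComputableSet A) (cG : ComputableRel (GraphOf g)) (cRan : ComputableSet (Ran g))
  (g-injective : Injectiveᶜ g)
  (starts : ∀ i b → ∃ λ x → b ≤ x × LongChainStart A g i x) where

  -- Vanishes at z iff g z = y, or everywhere when y ∉ ran g; arguments (z , y).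
  preimageTestᶜ : Code 2
  preimageTestᶜ = comp (proj₁ cRan) (proj (fs fz) ∷ []) ∸ᶜ comp (proj₁ cG) (proj fz ∷ proj (fs fz) ∷ [])

  preimageᶜ : Code 1
  preimageᶜ = mu preimageTestᶜ

  private
    preimage-search : ∀ y → ∃ λ x → χ cRan y ∸ χ₂ cG x y ≡ 0 × preimageᶜ ⟨ y ⟩≃ x
    preimage-search y = μ-halts preimageTestᶜ (y ∷ []) (λ z → χ cRan y ∸ χ₂ cG z y)
      (λ z → eval-∸ᶜ (eval-comp₁ e-proj (eval-χ cRan y)) (eval-comp₂ e-proj e-proj (eval-χ₂ cG z y)))
      root
      where
      root : ∃ λ z → χ cRan y ∸ χ₂ cG z y ≡ 0
      root = [ (λ ((x , gx) , _) → x , cong₂ _∸_ (χ-∈ cRan (x , gx)) (χ₂-∈ cG gx))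
             , (λ (y∉ran , _) → 0 , trans (cong (_∸ χ₂ cG 0 y) (χ-∉ cRan y∉ran)) (0∸n≡0 (χ₂ cG 0 y))) ]′
             (proj₂ cRan y)

  preimage : ℕ → ℕ
  preimage y = proj₁ (preimage-search y)

  eval-preimageᶜ : ∀ y → preimageᶜ ⟨ y ⟩≃ preimage y
  eval-preimageᶜ y = proj₂ (proj₂ (preimage-search y))

  preimage-spec : ∀ {y} → Ran g y → g ⟨ preimage y ⟩≃ y
  preimage-spec {y} y∈ran = 1∸χ₂≡0⇒∈ cG
    (subst (λ v → v ∸ χ₂ cG (preimage y) y ≡ 0) (χ-∈ cRan y∈ran) (proj₁ (proj₂ (preimage-search y))))

  preimage^ : ℕ → ℕ → ℕ
  preimage^ zero w = w
  preimage^ (suc s) w = preimage (preimage^ s w)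

  preimage^ᶜ : Code 2
  preimage^ᶜ = prec (proj fz) (comp preimageᶜ (proj (fs fz) ∷ []))

  eval-preimage^ᶜ : ∀ s w → Eval preimage^ᶜ (s ∷ w ∷ []) (preimage^ s w)
  eval-preimage^ᶜ zero w = e-prec0 e-proj
  eval-preimage^ᶜ (suc s) w = e-precS (eval-preimage^ᶜ s w) (eval-comp₁ e-proj (eval-preimageᶜ _))

  -- The number of steps t < s at which walking backwards from w gets stuck.
  stuckSteps : ℕ → ℕ → ℕ
  stuckSteps zero w = 0
  stuckSteps (suc s) w = stuckSteps s w + (1 ∸ χ cRan (preimage^ s w))

  stuckStepsᶜ : Code 2
  stuckStepsᶜ = prec zer (proj (fs fz) +ᶜ (oneᶜ ∸ᶜ comp (proj₁ cRan)
                  (comp preimage^ᶜ (proj fz ∷ proj (fs (fs fz)) ∷ []) ∷ [])))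

  eval-stuckStepsᶜ : ∀ s w → Eval stuckStepsᶜ (s ∷ w ∷ []) (stuckSteps s w)
  eval-stuckStepsᶜ zero w = e-prec0 e-zer
  eval-stuckStepsᶜ (suc s) w = e-precS (eval-stuckStepsᶜ s w)
    (eval-+ᶜ e-proj (eval-∸ᶜ eval-oneᶜ (eval-comp₁ (eval-comp₂ e-proj e-proj (eval-preimage^ᶜ s w))
                                                     (eval-χ cRan _))))

  stuckSteps≡0⇒iterate : ∀ s w → stuckSteps s w ≡ 0 → Iterate g s (preimage^ s w) w
  stuckSteps≡0⇒iterate zero w _ = refl
  stuckSteps≡0⇒iterate (suc s) w stuck≡0 =
    preimage^ s w ,
    preimage-spec (1∸χ≡0⇒∈ cRan (m+n≡0⇒n≡0 (stuckSteps s w) stuck≡0)) ,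
    stuckSteps≡0⇒iterate s w (m+n≡0⇒m≡0 (stuckSteps s w) stuck≡0)

  iterate⇒stuckSteps≡0 : ∀ i {x w} → Iterate g i x w → preimage^ i w ≡ x × stuckSteps i w ≡ 0
  iterate⇒stuckSteps≡0 zero refl = refl , refl
  iterate⇒stuckSteps≡0 (suc i) (z , gx , it) with iterate⇒stuckSteps≡0 i it
  ... | refl , stuck≡0 =
    g-injective _ _ _ (preimage-spec (_ , gx)) gx ,
    cong₂ _+_ stuck≡0 (cong (1 ∸_) (χ-∈ cRan (_ , gx)))

  startDefect : ℕ → ℕ → ℕ
  startDefect b x = χ cRan x + (1 ∸ χ cA x) + (b ∸ x)

  walkDefect : ℕ → ℕ → ℕ → ℕ
  walkDefect i b w = stuckSteps i w + startDefect b (preimage^ i w)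

  -- walkEndᶜ and walkDefectᶜ take arguments (w , b , i).
  walkEndᶜ : Code 3
  walkEndᶜ = comp preimage^ᶜ (proj (fs (fs fz)) ∷ proj fz ∷ [])

  eval-walkEndᶜ : ∀ i b w → Eval walkEndᶜ (w ∷ b ∷ i ∷ []) (preimage^ i w)
  eval-walkEndᶜ i b w = eval-comp₂ e-proj e-proj (eval-preimage^ᶜ i w)

  walkDefectᶜ : Code 3
  walkDefectᶜ = comp stuckStepsᶜ (proj (fs (fs fz)) ∷ proj fz ∷ []) +ᶜ
                (comp (proj₁ cRan) (walkEndᶜ ∷ []) +ᶜ (oneᶜ ∸ᶜ comp (proj₁ cA) (walkEndᶜ ∷ [])) +ᶜ
                 (proj (fs fz) ∸ᶜ walkEndᶜ))

  eval-walkDefectᶜ : ∀ i b w → Eval walkDefectᶜ (w ∷ b ∷ i ∷ []) (walkDefect i b w)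
  eval-walkDefectᶜ i b w =
    eval-+ᶜ (eval-comp₂ e-proj e-proj (eval-stuckStepsᶜ i w))
            (eval-+ᶜ (eval-+ᶜ (eval-comp₁ eval-end (eval-χ cRan _))
                              (eval-∸ᶜ eval-oneᶜ (eval-comp₁ eval-end (eval-χ cA _))))
                     (eval-∸ᶜ e-proj eval-end))
    where
    eval-end : Eval walkEndᶜ (w ∷ b ∷ i ∷ []) (preimage^ i w)
    eval-end = eval-walkEndᶜ i b w

  walkDefect≡0⇒start : ∀ i b w → walkDefect i b w ≡ 0 →
                       b ≤ preimage^ i w × LongChainStart A g i (preimage^ i w)
  walkDefect≡0⇒start i b w walk≡0 =
    m∸n≡0⇒m≤n (m+n≡0⇒n≡0 (χ cRan x + (1 ∸ χ cA x)) start≡0) ,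
    χ≡0⇒∉ cRan (m+n≡0⇒m≡0 _ (m+n≡0⇒m≡0 _ start≡0)) ,
    1∸χ≡0⇒∈ cA (m+n≡0⇒n≡0 (χ cRan x) (m+n≡0⇒m≡0 _ start≡0)) ,
    w , stuckSteps≡0⇒iterate i w (m+n≡0⇒m≡0 _ walk≡0)
    where
    x : ℕ
    x = preimage^ i w
    start≡0 : startDefect b x ≡ 0
    start≡0 = m+n≡0⇒n≡0 (stuckSteps i w) walk≡0

  walkDefect-root : ∀ i b → ∃ λ w → walkDefect i b w ≡ 0
  walkDefect-root i b with starts i b
  ... | x , b≤x , x∉ran , x∈A , w , it with iterate⇒stuckSteps≡0 i it
  ... | refl , stuck≡0 = w , cong₂ _+_ stuck≡0
          (cong₂ _+_ (cong₂ _+_ (χ-∉ cRan x∉ran) (cong (1 ∸_) (χ-∈ cA x∈A))) (m≤n⇒m∸n≡0 b≤x))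

  -- Arguments (b , i).
  chainStartᶜ : Code 2
  chainStartᶜ = comp preimage^ᶜ (proj (fs fz) ∷ mu walkDefectᶜ ∷ [])

  chainStartᶜ-halts : ∀ i b → ∃ λ x → Eval chainStartᶜ (b ∷ i ∷ []) x × b ≤ x × LongChainStart A g i x
  chainStartᶜ-halts i b
    with μ-halts walkDefectᶜ (b ∷ i ∷ []) (walkDefect i b) (eval-walkDefectᶜ i b) (walkDefect-root i b)
  ... | w , walk≡0 , eval-w =
    preimage^ i w , eval-comp₂ e-proj eval-w (eval-preimage^ᶜ i w) , walkDefect≡0⇒start i b w walk≡0

  chainStartᶜ-spec : ∀ {i b x} → Eval chainStartᶜ (b ∷ i ∷ []) x → b ≤ x × LongChainStart A g i x
  chainStartᶜ-spec {i} {b} e with chainStartᶜ-halts i b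
  ... | x , e′ , spec with eval-functional e e′
  ... | refl = spec

  nthStartᶜ : ℕ → Code 1
  nthStartᶜ zero = comp chainStartᶜ (zer ∷ proj fz ∷ [])
  nthStartᶜ (suc j) = comp chainStartᶜ (comp succ (nthStartᶜ j ∷ []) ∷ proj fz ∷ [])

  nthStartᶜ-halts : ∀ j i → nthStartᶜ j ⟨ i ⟩↓
  nthStartᶜ-halts zero i = let (x , e , _) = chainStartᶜ-halts i 0 in x , eval-comp₂ e-zer e-proj e
  nthStartᶜ-halts (suc j) i =
    let (r , eval-r) = nthStartᶜ-halts j i
        (x , e , _) = chainStartᶜ-halts i (suc r)
    in x , eval-comp₂ (eval-comp₁ eval-r e-succ) e-proj e

  nthStartᶜ-spec : ∀ j {i x} → nthStartᶜ j ⟨ i ⟩≃ x → LongChainStart A g i x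
  nthStartᶜ-spec zero (e-comp (_ ∷ e-proj ∷ []) e) = proj₂ (chainStartᶜ-spec e)
  nthStartᶜ-spec (suc j) (e-comp (_ ∷ e-proj ∷ []) e) = proj₂ (chainStartᶜ-spec e)

  nthStart : ℕ → ℕ → ℕ
  nthStart j i = proj₁ (nthStartᶜ-halts j i)

  nthStartᶜ-step : ∀ j {i x y} → nthStartᶜ j ⟨ i ⟩≃ x → nthStartᶜ (suc j) ⟨ i ⟩≃ y → x < y
  nthStartᶜ-step j eval-x (e-comp (e-comp (eval-r ∷ []) e-succ ∷ e-proj ∷ []) e)
    with eval-functional eval-r eval-x
  ... | refl = proj₁ (chainStartᶜ-spec e)

  nthStart-increasing : ∀ i j → nthStart j i < nthStart (suc j) i
  nthStart-increasing i j =
    nthStartᶜ-step j (proj₂ (nthStartᶜ-halts j i)) (proj₂ (nthStartᶜ-halts (suc j) i))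

  nthStartᶜ-injective : ∀ {j k i x} → nthStartᶜ j ⟨ i ⟩≃ x → nthStartᶜ k ⟨ i ⟩≃ x → j ≡ k
  nthStartᶜ-injective {j} {k} {i} e e′ = increasing⇒injective (nthStart-increasing i)
    (trans (eval-functional (proj₂ (nthStartᶜ-halts j i)) e)
           (eval-functional e′ (proj₂ (nthStartᶜ-halts k i))))

record IsCongruent (S : Struct) : Set where
  open Struct S
  field
    ≈-refl  : ∀ {x} → x ≈ x
    ≈-sym   : ∀ {x y} → x ≈ y → y ≈ x
    ≈-trans : ∀ {x y z} → x ≈ y → y ≈ z → x ≈ z
    G-respˡ : ∀ {x x′ y} → x ≈ x′ → G x y → G x′ y
    G-respʳ : ∀ {x y y′} → y ≈ y′ → G x y → G x y′

module _ {S : Struct} (congS : IsCongruent S) where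
  open Struct S
  open IsCongruent congS

  iter-respˡ : ∀ n {x x′ y} → x ≈ x′ → Iter S n x y → Iter S n x′ y
  iter-respˡ zero x≈x′ x≈y = ≈-trans (≈-sym x≈x′) x≈y
  iter-respˡ (suc n) x≈x′ (z , gz , it) = z , G-respˡ x≈x′ gz , it

  iter-respʳ : ∀ n {x y y′} → y ≈ y′ → Iter S n x y → Iter S n x y′
  iter-respʳ zero y≈y′ x≈y = ≈-trans x≈y y≈y′
  iter-respʳ (suc n) y≈y′ (z , gz , it) = z , gz , iter-respʳ n y≈y′ it

  iter-snoc : ∀ n {x y z} → Iter S n x y → G y z → Iter S (suc n) x z
  iter-snoc zero x≈y gz = _ , G-respˡ (≈-sym x≈y) gz , ≈-refl
  iter-snoc (suc n) (u , gu , it) gz = u , gu , iter-snoc n it gz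

module _ {S T : Struct} (congT : IsCongruent T) (iso : Iso S T) where
  open Iso iso
  open IsCongruent congT

  iter-to : ∀ n {x y} → Iter S n x y → Iter T n (to x) (to y)
  iter-to zero x≈y = to-cong x≈y
  iter-to (suc n) (z , gz , it) = to z , G-to _ _ gz , iter-to n it

  iter-from : ∀ n {x y} → Iter T n x y → Iter S n (from x) (from y)
  iter-from zero x≈y = from-cong x≈y
  iter-from (suc n) {x} (z , gz , it) =
    from z , G-from _ _ (G-respˡ (≈-sym (to-from x)) (G-respʳ (≈-sym (to-from z)) gz)) , iter-from n it

  iter-to-from : ∀ n {x y} → Iter S n (from x) (from y) → Iter T n x y
  iter-to-from n it = iter-respʳ congT n (to-from _) (iter-respˡ congT n (to-from _) (iter-to n it))

  omegaStart-from : ∀ {x} → OmegaStart T x → OmegaStart S (from x)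
  omegaStart-from {x} (x∉ran , iterates , iterates-distinct) =
    (λ (z , gz) → x∉ran (to z , G-respʳ (to-from x) (G-to _ _ gz))) ,
    (λ n → let (y , it) = iterates n in from y , iter-from n it) ,
    (λ n m y y′ it it′ y≈y′ → iterates-distinct n m (to y) (to y′)
       (iter-respˡ congT n (to-from x) (iter-to n it)) (iter-respˡ congT m (to-from x) (iter-to m it′))
       (to-cong y≈y′))

  sameOrbit-from⁻ : ∀ {x y} → SameOrbit S (from x) (from y) → SameOrbit T x y
  sameOrbit-from⁻ (n , inj₁ it) = n , inj₁ (iter-to-from n it)
  sameOrbit-from⁻ (n , inj₂ it) = n , inj₂ (iter-to-from n it)

  infManyOmega-from : InfManyOmega T → InfManyOmega S
  infManyOmega-from (s , s-omega , s-distinct) =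
    (λ i → from (s i)) , (λ i → omegaStart-from (s-omega i)) ,
    (λ i j i≢j same → s-distinct i j i≢j (sameOrbit-from⁻ same))

module _ (S : Struct) where

  infManyOmega⇒¬finManyOmega :
    (∀ {x y e} → OmegaStart S x → OmegaStart S y → SameOrbit S x e → SameOrbit S y e → SameOrbit S x y) →
    InfManyOmega S → ¬ FinManyOmega S
  infManyOmega⇒¬finManyOmega merge (s , s-omega , s-distinct) (l , cover)
    with pigeonhole (n<1+n (length l)) (λ k → index (cover (s (toℕ k)) (s-omega (toℕ k))))
  ... | k , k′ , k<k′ , same = s-distinct (toℕ k) (toℕ k′) (<⇒≢ k<k′)
    (merge (s-omega _) (s-omega _) (covered (toℕ k))
           (subst (λ m → SameOrbit S (s (toℕ k′)) (lookup l m)) (sym same) (covered (toℕ k′))))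
    where
    covered : ∀ i → SameOrbit S (s i) (lookup l (index (cover (s i) (s-omega i))))
    covered i = lookup-index (cover (s i) (s-omega i))

withGraph : (S : Struct) → (Struct.Carrier S → Struct.Carrier S → Set) → Struct
withGraph S G′ = record { Carrier = Struct.Carrier S ; _≈_ = Struct._≈_ S ; G = G′ }

module Converse {S : Struct} (congS : IsCongruent S) {G′ : Struct.Carrier S → Struct.Carrier S → Set}
  (G′⇒G : ∀ x y → G′ x y → Struct.G S y x) (G⇒G′ : ∀ x y → Struct.G S x y → G′ y x) where
  open Struct S
  open IsCongruent congS

  T : Struct
  T = withGraph S G′

  congT : IsCongruent T
  congT = record
    { ≈-refl = ≈-refl ; ≈-sym = ≈-sym ; ≈-trans = ≈-trans
    ; G-respˡ = λ x≈x′ g′ → G⇒G′ _ _ (G-respʳ x≈x′ (G′⇒G _ _ g′))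
    ; G-respʳ = λ y≈y′ g′ → G⇒G′ _ _ (G-respˡ y≈y′ (G′⇒G _ _ g′)) }

  iter-reverse : ∀ n {x y} → Iter T n x y → Iter S n y x
  iter-reverse zero x≈y = ≈-sym x≈y
  iter-reverse (suc n) (z , g′ , it) = iter-snoc congS n (iter-reverse n it) (G′⇒G _ _ g′)

  iter-reverse⁻ : ∀ n {x y} → Iter S n x y → Iter T n y x
  iter-reverse⁻ zero x≈y = ≈-sym x≈y
  iter-reverse⁻ (suc n) (z , gz , it) = iter-snoc congT n (iter-reverse⁻ n it) (G⇒G′ _ _ gz)

  omegaStart⇒omegaStarStart : ∀ {x} → OmegaStart T x → OmegaStarStart S x
  omegaStart⇒omegaStarStart (x∉ran , iterates , iterates-distinct) =
    (λ (z , gz) → x∉ran (z , G⇒G′ _ _ gz)) ,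
    (λ n → let (y , it) = iterates n in y , iter-reverse n it) ,
    (λ n m y y′ it it′ → iterates-distinct n m y y′ (iter-reverse⁻ n it) (iter-reverse⁻ m it′))

  sameOrbit-reverse⁻ : ∀ {x y} → SameOrbit S x y → SameOrbit T x y
  sameOrbit-reverse⁻ (n , inj₁ it) = n , inj₂ (iter-reverse⁻ n it)
  sameOrbit-reverse⁻ (n , inj₂ it) = n , inj₁ (iter-reverse⁻ n it)

  infManyOmega⇒infManyOmegaStar : InfManyOmega T → InfManyOmegaStar S
  infManyOmega⇒infManyOmegaStar (s , s-omega , s-distinct) =
    s , (λ i → omegaStart⇒omegaStarStart (s-omega i)) ,
    (λ i j i≢j same → s-distinct i j i≢j (sameOrbit-reverse⁻ same))

  finManyOmegaStar⇒finManyOmega : FinManyOmegaStar S → FinManyOmega T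
  finManyOmegaStar⇒finManyOmega (l , cover) =
    l , λ x x-omega → Any.map sameOrbit-reverse⁻ (cover x (omegaStart⇒omegaStarStart x-omega))

iso-converse : ∀ {S₁ S₂ : Struct} {G₁′ G₂′} →
  (∀ x y → G₁′ x y → Struct.G S₁ y x) → (∀ x y → Struct.G S₁ x y → G₁′ y x) →
  (∀ x y → G₂′ x y → Struct.G S₂ y x) → (∀ x y → Struct.G S₂ x y → G₂′ y x) →
  Iso S₁ S₂ → Iso (withGraph S₁ G₁′) (withGraph S₂ G₂′)
iso-converse G₁′⇒G₁ G₁⇒G₁′ G₂′⇒G₂ G₂⇒G₂′ iso = record
  { to = to ; from = from ; to-cong = to-cong ; from-cong = from-cong
  ; from-to = from-to ; to-from = to-from
  ; G-to = λ x y g′ → G₂⇒G₂′ _ _ (G-to y x (G₁′⇒G₁ _ _ g′))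
  ; G-from = λ x y g′ → G₁⇒G₁′ _ _ (G-from y x (G₂′⇒G₂ _ _ g′)) }
  where open Iso iso

structOf-congruent : ∀ {A g} → IsCongruent (StructOf A g)
structOf-congruent {g = g} = record
  { ≈-refl = refl ; ≈-sym = sym ; ≈-trans = trans
  ; G-respˡ = λ x≡x′ → subst (λ x → g ⟨ x ⟩≃ _) x≡x′
  ; G-respʳ = λ y≡y′ → subst (g ⟨ _ ⟩≃_) y≡y′ }

module _ {A : ℕ → Set} {g : Code 1} where

  iter⇒iterate : ∀ n {x y} → Iter (StructOf A g) n x y → Iterate g n (proj₁ x) (proj₁ y)
  iter⇒iterate zero x≡y = x≡y
  iter⇒iterate (suc n) (z , gz , it) = proj₁ z , gz , iter⇒iterate n it

  sameOrbit⇒iterate : ∀ {x e} → ¬ Ran g (proj₁ x) → SameOrbit (StructOf A g) x e →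
                      ∃ λ n → Iterate g n (proj₁ x) (proj₁ e)
  sameOrbit⇒iterate _ (n , inj₁ it) = n , iter⇒iterate n it
  sameOrbit⇒iterate x∉ran (n , inj₂ it) = 0 , sym (iterate-to-non-range n x∉ran (iter⇒iterate n it))

  module _ (g-into : ∀ x y → g ⟨ x ⟩≃ y → A x × A y) where

    iterate⇒iter : ∀ n {x y} → Iterate g n (proj₁ x) (proj₁ y) → Iter (StructOf A g) n x y
    iterate⇒iter zero x≡y = x≡y
    iterate⇒iter (suc n) (u , gu , it) = (u , proj₂ (g-into _ _ gu)) , gu , iterate⇒iter n it

    ¬inRan⇒¬ran : ∀ {x} → ¬ InRan (StructOf A g) x → ¬ Ran g (proj₁ x)
    ¬inRan⇒¬ran x∉ran (u , gu) = x∉ran ((u , proj₁ (g-into _ _ gu)) , gu)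

    ¬inDom⇒¬dom : ∀ {x} → ¬ InDom (StructOf A g) x → ¬ Dom g (proj₁ x)
    ¬inDom⇒¬dom x∉dom (v , gv) = x∉dom ((v , proj₂ (g-into _ _ gv)) , gv)

    unboundedFCC⇒arbitrarilyLongChains : UnboundedFCC (StructOf A g) → ArbitrarilyLongChains A g
    unboundedFCC⇒arbitrarilyLongChains fcc b with fcc b
    ... | suc k , b<1+k , x , x∉ran , (y , it , y∉dom) , _ =
      k , ≤-pred b<1+k , proj₁ x , ¬inRan⇒¬ran {x} x∉ran , proj₂ x ,
      proj₁ y , iter⇒iterate k it , ¬inDom⇒¬dom {y} y∉dom

    module _ (g-injective : Injectiveᶜ g) where

      sameOrbit-omegaStarts : ∀ {x y e} → OmegaStart (StructOf A g) x → OmegaStart (StructOf A g) y →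
        SameOrbit (StructOf A g) x e → SameOrbit (StructOf A g) y e → SameOrbit (StructOf A g) x y
      sameOrbit-omegaStarts {x} {y} (x∉ran , _) (y∉ran , _) x~e y~e
        with sameOrbit⇒iterate (¬inRan⇒¬ran {x} x∉ran) x~e
           | sameOrbit⇒iterate (¬inRan⇒¬ran {y} y∉ran) y~e
      ... | n , it | m , it′ with ≤-total n m
      ... | inj₁ n≤m = m ∸ n , inj₂ (iterate⇒iter (m ∸ n) (iterate-converge g-injective n≤m it it′))
      ... | inj₂ m≤n = n ∸ m , inj₁ (iterate⇒iter (n ∸ m) (iterate-converge g-injective m≤n it′ it))

module _ {X : ℕ → Set} where

  ⊆*-map : ∀ {P Q : ℕ → Set} → (∀ {i} → P i → Q i) → X ⊆* P → X ⊆* Q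
  ⊆*-map f (N , h) = N , λ i N≤i i∈X → f (h i N≤i i∈X)

  ⊆*-zip : ∀ {P Q : ℕ → Set} → X ⊆* P → X ⊆* Q → X ⊆* (λ i → P i × Q i)
  ⊆*-zip (M , h) (N , k) = M ⊔ N , λ i M⊔N≤i i∈X →
    h i (≤-trans (m≤m⊔n M N) M⊔N≤i) i∈X , k i (≤-trans (m≤n⊔m M N) M⊔N≤i) i∈X

  ⊆*-witness : Infinite X → ∀ {P : ℕ → Set} → X ⊆* P → ∃ P
  ⊆*-witness X-infinite (N , h) = let (i , N≤i , i∈X) = X-infinite N in i , h i N≤i i∈X

module _ {A : ℕ → Set} {g : Code 1} {C : ℕ → Set} where
  open PowerElt

  power-congruent : IsCongruent (CohesivePower A g C)
  power-congruent = record
    { ≈-refl = λ {p} → ⊆*-map (λ (y , e) → y , e , e) (ψ-dom p)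
    ; ≈-sym = ⊆*-map (λ (y , e , e′) → y , e′ , e)
    ; ≈-trans = λ p≈q q≈r → ⊆*-map
        (λ ((y , ep , eq) , (y′ , eq′ , er)) → y , ep , subst (_ ⟨ _ ⟩≃_) (eval-functional eq′ eq) er)
        (⊆*-zip p≈q q≈r)
    ; G-respˡ = λ p≈p′ gpq → ⊆*-map
        (λ ((y , ep , ep′) , (a , b , ea , eb , gab)) →
           a , b , subst (_ ⟨ _ ⟩≃_) (eval-functional ep ea) ep′ , eb , gab)
        (⊆*-zip p≈p′ gpq)
    ; G-respʳ = λ q≈q′ gpq → ⊆*-map
        (λ ((y , eq , eq′) , (a , b , ea , eb , gab)) →
           a , b , ea , subst (_ ⟨ _ ⟩≃_) (eval-functional eq eb) eq′ , gab)
        (⊆*-zip q≈q′ gpq) }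

  IterateAt : ℕ → PowerElt A C → PowerElt A C → ℕ → Set
  IterateAt n p q i = ∃₂ λ a b → ψ p ⟨ i ⟩≃ a × ψ q ⟨ i ⟩≃ b × Iterate g n a b

  power-iter⇒pointwise : ∀ n {p q} → Iter (CohesivePower A g C) n p q → C ⊆* IterateAt n p q
  power-iter⇒pointwise zero p≈q = ⊆*-map (λ (y , ep , eq) → y , y , ep , eq , refl) p≈q
  power-iter⇒pointwise (suc n) (z , gpz , it) = ⊆*-map
    (λ ((a , b , ea , eb , gab) , (b′ , c , eb′ , ec , it′)) →
       a , c , ea , ec , b , gab , subst (λ v → Iterate g n v c) (eval-functional eb′ eb) it′)
    (⊆*-zip gpz (power-iter⇒pointwise n it))

-- ω-chains and ω*-chains of the cohesive power

module ComputablePIS {A : ℕ → Set} {g : Code 1} (pis : IsComputablePIS A g) where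

  cA : ComputableSet A
  cA = proj₁ pis

  cG : ComputableRel (GraphOf g)
  cG = proj₁ (proj₂ pis)

  g-into : ∀ x y → g ⟨ x ⟩≃ y → A x × A y
  g-into = proj₁ (proj₂ (proj₂ pis))

  g-injective : Injectiveᶜ g
  g-injective = proj₂ (proj₂ (proj₂ pis))

module OmegaChainsInPower {A : ℕ → Set} {g : Code 1} (pis : IsComputablePIS A g)
  (chains : ArbitrarilyLongChains A g) {C : ℕ → Set} (C-infinite : Infinite C)
  (cRan : ComputableSet (Ran g)) where

  open PowerElt
  open ComputablePIS pis
  private
    P : Struct
    P = CohesivePower A g C

  open ChainStartEnumeration cA cG cRan g-injective (longChainStarts-unbounded chains)

  -- Component i is f^m of the j-th start of a chain with at least i steps, defined for i ≥ m.
  chainElt : ℕ → ℕ → PowerElt A C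
  chainElt j m = record
    { ψ = iterateᶜ g m (nthStartᶜ j) ; ψ-into = into m ; ψ-dom = m , λ i m≤i _ → defined m≤i }
    where
    into : ∀ m i y → iterateᶜ g m (nthStartᶜ j) ⟨ i ⟩≃ y → A y
    into zero i y e = proj₁ (proj₂ (nthStartᶜ-spec j e))
    into (suc m) i y (e-comp (_ ∷ []) gy) = proj₂ (g-into _ _ gy)

    defined : ∀ {i} → m ≤ i → iterateᶜ g m (nthStartᶜ j) ⟨ i ⟩↓
    defined {i} m≤i =
      let (x , eval-x) = nthStartᶜ-halts j i
          (_ , _ , _ , it) = nthStartᶜ-spec j eval-x
          (y , it′) = iterate-prefix m≤i it
      in y , eval-iterateᶜ m eval-x it′

  chainElt-step-at : ∀ j m {i} → suc m ≤ i →
    ∃₂ λ a b → ψ (chainElt j m) ⟨ i ⟩≃ a × ψ (chainElt j (suc m)) ⟨ i ⟩≃ b × g ⟨ a ⟩≃ b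
  chainElt-step-at j m {i} m<i =
    let (x , eval-x) = nthStartᶜ-halts j i
        (_ , _ , _ , it) = nthStartᶜ-spec j eval-x
        (b , it′) = iterate-prefix m<i it
        (a , it″ , gab) = iterate-unsnoc m it′
        eval-a = eval-iterateᶜ m eval-x it″
    in a , b , eval-a , eval-comp₁ eval-a gab , gab

  chainElt-step : ∀ j m → Struct.G P (chainElt j m) (chainElt j (suc m))
  chainElt-step j m = suc m , λ i m<i _ → chainElt-step-at j m m<i

  chainElt-iterates : ∀ j n m → ∃ (Iter P n (chainElt j m))
  chainElt-iterates j zero m = chainElt j m , IsCongruent.≈-refl (power-congruent {g = g}) {chainElt j m}
  chainElt-iterates j (suc n) m =
    let (y , it) = chainElt-iterates j n (suc m) in y , chainElt j (suc m) , chainElt-step j m , it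

  start : ℕ → PowerElt A C
  start j = chainElt j 0

  start-omega : ∀ j → OmegaStart P (start j)
  start-omega j = start∉ran , (λ n → chainElt-iterates j n 0) , iterates-distinct
    where
    start∉ran : ¬ InRan P (start j)
    start∉ran (_ , g-start) =
      let (_ , a , b , _ , eval-b , gab) = ⊆*-witness C-infinite g-start
      in proj₁ (nthStartᶜ-spec j eval-b) (a , gab)

    iterates-distinct : ∀ n m y y′ → Iter P n (start j) y → Iter P m (start j) y′ →
                        Struct._≈_ P y y′ → n ≡ m
    iterates-distinct n m y y′ it it′ y≈y′ =
      let (_ , ((a , b , ea , eb , itn) , (a′ , b′ , ea′ , eb′ , itm)) , (c , ec , ec′)) =
            ⊆*-witness C-infinite
              (⊆*-zip (⊆*-zip (power-iter⇒pointwise n it) (power-iter⇒pointwise m it′)) y≈y′)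
          a′≡a = eval-functional ea′ ea
          b′≡b = trans (eval-functional eb′ ec′) (eval-functional ec eb)
      in iterate-length-from-non-range g-injective n m (proj₁ (nthStartᶜ-spec j ea)) itn
           (subst₂ (Iterate g m) a′≡a b′≡b itm)

  iter-between-starts : ∀ n {j k} → Iter P n (start j) (start k) → j ≡ k
  iter-between-starts n {j} {k} it =
    let (i , a , b , ea , eb , it′) = ⊆*-witness C-infinite (power-iter⇒pointwise n it)
        a≡b = iterate-to-non-range n (proj₁ (nthStartᶜ-spec k eb)) it′
    in nthStartᶜ-injective ea (subst (nthStartᶜ k ⟨ i ⟩≃_) (sym a≡b) eb)

  infManyOmega : InfManyOmega P
  infManyOmega = start , start-omega , distinct
    where
    distinct : ∀ j k → j ≢ k → ¬ SameOrbit P (start j) (start k)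
    distinct j k j≢k (n , inj₁ it) = j≢k (iter-between-starts n it)
    distinct j k j≢k (n , inj₂ it) = j≢k (sym (iter-between-starts n it))

  ¬iso : FinManyOmega (StructOf A g) → ¬ Iso (StructOf A g) P
  ¬iso fin iso = infManyOmega⇒¬finManyOmega (StructOf A g) (sameOrbit-omegaStarts g-into g-injective)
    (infManyOmega-from power-congruent iso infManyOmega) fin

module InverseCode {A : ℕ → Set} {g : Code 1} (pis : IsComputablePIS A g) where

  open ComputablePIS pis

  -- Arguments (x , y): vanishes iff g x = y.
  inverseTestᶜ : Code 2
  inverseTestᶜ = oneᶜ ∸ᶜ proj₁ cG

  eval-inverseTestᶜ : ∀ x y → Eval inverseTestᶜ (x ∷ y ∷ []) (1 ∸ χ₂ cG x y)
  eval-inverseTestᶜ x y = eval-∸ᶜ eval-oneᶜ (eval-χ₂ cG x y)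

  inverseᶜ : Code 1
  inverseᶜ = mu inverseTestᶜ

  inverseᶜ-sound : ∀ {x y} → inverseᶜ ⟨ y ⟩≃ x → g ⟨ x ⟩≃ y
  inverseᶜ-sound {x} {y} (e-mu root _) = 1∸χ₂≡0⇒∈ cG (eval-functional (eval-inverseTestᶜ x y) root)

  inverseᶜ-complete : ∀ {x y} → g ⟨ x ⟩≃ y → inverseᶜ ⟨ y ⟩≃ x
  inverseᶜ-complete {x} {y} gxy
    with μ-halts inverseTestᶜ (y ∷ []) (λ z → 1 ∸ χ₂ cG z y) (λ z → eval-inverseTestᶜ z y)
                 (x , cong (1 ∸_) (χ₂-∈ cG gxy))
  ... | x′ , _ , eval-x′ with g-injective _ _ _ (inverseᶜ-sound eval-x′) gxy
  ... | refl = eval-x′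

  -- Arguments (y , x).
  inverseGraphᶜ : Code 2
  inverseGraphᶜ = comp (proj₁ cG) (proj (fs fz) ∷ proj fz ∷ [])

  inverse-graph-computable : ComputableRel (GraphOf inverseᶜ)
  inverse-graph-computable = inverseGraphᶜ , λ y x →
    [ (λ (gxy , e) → inj₁ (inverseᶜ-complete gxy , eval-comp₂ e-proj e-proj e))
    , (λ (¬gxy , e) → inj₂ ((λ inv → ¬gxy (inverseᶜ-sound inv)) , eval-comp₂ e-proj e-proj e)) ]′
    (proj₂ cG x y)

  inverse-pis : IsComputablePIS A inverseᶜ
  inverse-pis =
    cA , inverse-graph-computable ,
    (λ y x inv → swap (g-into x y (inverseᶜ-sound inv))) ,
    (λ y y′ x inv inv′ → eval-functional (inverseᶜ-sound inv) (inverseᶜ-sound inv′))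

  inverse-ran : ComputableSet (Dom g) → ComputableSet (Ran inverseᶜ)
  inverse-ran (c , decide) = c , λ x →
    [ (λ ((y , gxy) , e) → inj₁ ((y , inverseᶜ-complete gxy) , e))
    , (λ (x∉dom , e) → inj₂ ((λ (y , inv) → x∉dom (y , inverseᶜ-sound inv)) , e)) ]′ (decide x)

  iterate-inverse : ∀ n {x y} → Iterate g n x y → Iterate inverseᶜ n y x
  iterate-inverse zero refl = refl
  iterate-inverse (suc n) (z , gz , it) = iterate-snoc n (iterate-inverse n it) (inverseᶜ-complete gz)

  iterate-into : ∀ n {x y} → A x → Iterate g n x y → A y
  iterate-into zero x∈A refl = x∈A
  iterate-into (suc n) _ (z , gz , it) = iterate-into n (proj₂ (g-into _ _ gz)) it

  inverse-chains : ArbitrarilyLongChains A g → ArbitrarilyLongChains A inverseᶜ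
  inverse-chains chains b =
    let (k , b≤k , x , x∉ran , x∈A , y , it , y∉dom) = chains b
    in k , b≤k , y , (λ (z , inv) → y∉dom (z , inverseᶜ-sound inv)) , iterate-into k x∈A it ,
       x , iterate-inverse k it , (λ (z , inv) → x∉ran (z , inverseᶜ-sound inv))

  inverse-struct-graph : ∀ x y → Struct.G (StructOf A inverseᶜ) x y → Struct.G (StructOf A g) y x
  inverse-struct-graph _ _ = inverseᶜ-sound

  struct-graph-inverse : ∀ x y → Struct.G (StructOf A g) x y → Struct.G (StructOf A inverseᶜ) y x
  struct-graph-inverse _ _ = inverseᶜ-complete

  module _ {C : ℕ → Set} where

    inverse-power-graph : ∀ p q → Struct.G (CohesivePower A inverseᶜ C) p q →
                          Struct.G (CohesivePower A g C) q p
    inverse-power-graph _ _ = ⊆*-map (λ (a , b , ea , eb , inv) → b , a , eb , ea , inverseᶜ-sound inv)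

    power-graph-inverse : ∀ p q → Struct.G (CohesivePower A g C) p q →
                          Struct.G (CohesivePower A inverseᶜ C) q p
    power-graph-inverse _ _ =
      ⊆*-map (λ (a , b , ea , eb , gab) → b , a , eb , ea , inverseᶜ-complete gab)

module OmegaStarChainsInPower {A : ℕ → Set} {g : Code 1} (pis : IsComputablePIS A g)
  (chains : ArbitrarilyLongChains A g) {C : ℕ → Set} (C-infinite : Infinite C)
  (cDom : ComputableSet (Dom g)) where

  open InverseCode pis
  private
    module Inverse = OmegaChainsInPower inverse-pis (inverse-chains chains) C-infinite (inverse-ran cDom)
    module StructConverse = Converse (structOf-congruent {A} {g}) {Struct.G (StructOf A inverseᶜ)}
                              inverse-struct-graph struct-graph-inverse
    module PowerConverse = Converse (power-congruent {A} {g} {C}) {Struct.G (CohesivePower A inverseᶜ C)}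
                             inverse-power-graph power-graph-inverse

  infManyOmegaStar : InfManyOmegaStar (CohesivePower A g C)
  infManyOmegaStar = PowerConverse.infManyOmega⇒infManyOmegaStar Inverse.infManyOmega

  ¬iso : FinManyOmegaStar (StructOf A g) → ¬ Iso (StructOf A g) (CohesivePower A g C)
  ¬iso fin iso = Inverse.¬iso (StructConverse.finManyOmegaStar⇒finManyOmega fin)
    (iso-converse inverse-struct-graph struct-graph-inverse inverse-power-graph power-graph-inverse iso)

mainTheorem20 : (A : ℕ → Set) (cf : Code 1) →
    IsComputablePIS A cf → UnboundedFCC (StructOf A cf) →
    (C : ℕ → Set) → Cohesive C →
    (ComputableSet (Ran cf) →
       InfManyOmega (CohesivePower A cf C) ×
       (FinManyOmega (StructOf A cf) →
          ¬ Iso (StructOf A cf) (CohesivePower A cf C))) ×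
    (ComputableSet (Dom cf) →
       InfManyOmegaStar (CohesivePower A cf C) ×
       (FinManyOmegaStar (StructOf A cf) →
          ¬ Iso (StructOf A cf) (CohesivePower A cf C)))
mainTheorem20 A cf pis fcc C (C-infinite , _) =
  (λ cRan → let open OmegaChainsInPower pis chains C-infinite cRan in infManyOmega , ¬iso) ,
  (λ cDom → let open OmegaStarChainsInPower pis chains C-infinite cDom in infManyOmegaStar , ¬iso)
  where
  chains : ArbitrarilyLongChains A cf
  chains = unboundedFCC⇒arbitrarilyLongChains (ComputablePIS.g-into pis) fcc
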